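{- For every positive integer $n$, the number $f_0(\mathcal{P}_n)$ of vertices of $\mathcal{P}_n$ satisfies $$f_0(\mathcal{P}_n)\le \sum_{k=n}^{3n-2}\binom{n^3}{k}.$$
   Context: $\mathcal{P}_n\subset\mathbb{R}^{n^3}$ is the polytope of $n\times n\times n$ plane-stochastic tensors: real arrays $A=(a_{ijk})$, $1\le i,j,k\le n$, with $a_{ijk}\ge 0$, $\sum_{i,j}a_{ijk}=1$ for all $k$, $\sum_{j,k}a_{ijk}=1$ for all $i$, and $\sum_{i,k}a_{ijk}=1$ for all $j$.
   Formalization: The polytope $\mathcal{P}_n$ is taken over ℚ rather than ℝ: the tensors have rational entries, and vertices are extreme among rational points with rational convex-combination coefficients. -}

module Defs where

open import Data.Nat using (ℕ; zero; suc; _^_; _∸_) renaming (_+_ to _+ℕ_; _*_ to _*ℕ_)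
open import Data.Nat.Combinatorics using (_C_)
open import Data.Fin using (Fin; zero; suc)
open import Data.Rational using (ℚ; 0ℚ; 1ℚ; _+_; _*_; _-_; _≤_; _<_)
open import Data.List using (List; map; upTo)
open import Data.Nat.ListAction using (sum)
open import Data.Product using (_×_)
open import Relation.Binary.PropositionalEquality using (_≡_)

Σℚ : (n : ℕ) → (Fin n → ℚ) → ℚ
Σℚ zero    f = 0ℚ
Σℚ (suc n) f = f zero + Σℚ n (λ i → f (suc i))

Tensor : ℕ → Set
Tensor n = Fin n → Fin n → Fin n → ℚ

_≐_ : {n : ℕ} → Tensor n → Tensor n → Set
A ≐ B = ∀ i j k → A i j k ≡ B i j k

-- membership in the polytope P_n of plane-stochastic tensors
PlaneStochastic : (n : ℕ) → Tensor n → Set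
PlaneStochastic n A =
  (∀ i j k → 0ℚ ≤ A i j k)
  × (∀ k → Σℚ n (λ i → Σℚ n (λ j → A i j k)) ≡ 1ℚ)
  × (∀ i → Σℚ n (λ j → Σℚ n (λ k → A i j k)) ≡ 1ℚ)
  × (∀ j → Σℚ n (λ i → Σℚ n (λ k → A i j k)) ≡ 1ℚ)

IsVertex : (n : ℕ) → Tensor n → Set
IsVertex n A =
  PlaneStochastic n A
  × (∀ (B C : Tensor n) (t : ℚ) → PlaneStochastic n B → PlaneStochastic n C
       → 0ℚ < t → t < 1ℚ
       → (∀ i j k → A i j k ≡ t * B i j k + (1ℚ - t) * C i j k)
       → B ≐ C)

-- Σ_{k=n}^{3n-2} binom(n^3, k)   (terms k = n + m, m = 0 .. 2n-2)
vertexBound : ℕ → ℕ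
vertexBound n = sum (map (λ m → (n ^ 3) C (n +ℕ m)) (upTo ((2 *ℕ n) ∸ 1)))

{-# OPTIONS --safe #-}
-- A vertex A of the polytope is rigid: if D has zero slice sums and vanishes wherever A does,
-- then A ± t D lies in the polytope for some t > 0, and A = ½ (A + t D) + ½ (A - t D) forces D = 0.
-- Two vertices with the same support differ by such a D, so a vertex is determined by its support.
-- The 3n slice-sum functionals satisfy two linear relations, so 3n - 2 of them determine the rest;
-- a support of more than 3n - 2 cells would, by Gaussian elimination, carry a nonzero such D.
-- Every slice of A sums to 1, so the support also has at least n cells. Hence distinct vertices
-- have distinct supports, each a subset of the n³ cells of size between n and 3n - 2.
module Submission where

open import Algebra.Bundles using (Monoid; CommutativeRing)
open import Data.Bool using (true; not; if_then_else_)
open import Data.Fin as Fin using (Fin; zero; suc; _↑ˡ_; _↑ʳ_; combine)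
import Data.Fin.Properties as Fin
open import Data.Fin.Subset using (Subset; inside; outside; _∈_; _∉_; _-_; ∣_∣; Nonempty)
open import Data.Fin.Subset.Properties using (_∈?_; nonempty?; Empty-unique; ∣⊥∣≡0; p─⊥≡p; p─q⊆p; drop-there)
open import Data.List as List using (List; []; _∷_; length; upTo; concatMap; _++_)
import Data.List.Properties as Listₚ
open import Data.List.Membership.Propositional using () renaming (_∈_ to _∈ₗ_)
open import Data.List.Membership.Propositional.Properties using (∈-map⁺; ∈-++⁺ˡ; ∈-++⁺ʳ; ∈-concatMap⁺; ∈-upTo⁺)
open import Data.List.Relation.Unary.All as All using (All; []; _∷_)
import Data.List.Relation.Unary.All.Properties as Allₚ
open import Data.List.Relation.Unary.AllPairs using (AllPairs; []; _∷_)
open import Data.List.Relation.Unary.Any as Any using (here; there)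
open import Data.Nat as ℕ using (ℕ; zero; suc; _≤_; _<_; z≤n; s≤s; _∸_)
open import Data.Nat.Combinatorics using (_C_; nCk+nC[k+1]≡[n+1]C[k+1])
import Data.Nat.ListAction as ℕ
import Data.Nat.Properties as ℕ
open import Data.Product as Product using (∃-syntax; _×_; _,_; proj₁; proj₂)
open import Data.Rational as ℚ using (ℚ; 0ℚ; 1ℚ; ½; _+_; _*_; -_)
import Data.Rational.Properties as ℚ
open import Data.Rational.Solver using (module +-*-Solver)
open import Data.Sum using (inj₁; inj₂)
open import Data.Vec as Vec using (Vec; []; _∷_; here; there)
import Data.Vec.Properties as Vec
open import Data.Vec.Functional using (Vector)
open import Data.Vec.Relation.Unary.All as VecAll using ([]; _∷_)
import Data.Vec.Relation.Unary.All.Properties as VecAll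
open import Function using (_∘_)
open import Relation.Binary.PropositionalEquality
  using (_≡_; _≢_; refl; sym; trans; cong; cong₂; subst; subst₂; module ≡-Reasoning)
open import Relation.Nullary using (¬_; yes; no; does; contradiction; _×-dec_; ¬?)
open import Relation.Nullary.Decidable using (decidable-stable; from-yes)

open import Defs

module _ {c ℓ} (M : Monoid c ℓ) where
  open Monoid M using (Carrier; _≈_; ∙-congˡ; assoc; identityˡ)
    renaming (_∙_ to _⊕_; refl to ≈-refl; sym to ≈-sym; trans to ≈-trans)
  open import Algebra.Properties.Monoid.Sum M using (sum; sum-syntax)

  sum-↑ : ∀ m {n} (f : Vector Carrier (m ℕ.+ n)) → sum f ≈ ∑[ i < m ] f (i ↑ˡ n) ⊕ ∑[ j < n ] f (m ↑ʳ j)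
  sum-↑ zero    f = ≈-sym (identityˡ _)
  sum-↑ (suc m) f = ≈-trans (∙-congˡ (sum-↑ m (f ∘ suc))) (≈-sym (assoc _ _ _))

  sum-combine : ∀ m {n} (f : Vector Carrier (m ℕ.* n)) → sum f ≈ ∑[ i < m ] ∑[ j < n ] f (combine i j)
  sum-combine zero        f = ≈-refl
  sum-combine (suc m) {n} f = ≈-trans (sum-↑ n f) (∙-congˡ (sum-combine m (f ∘ (n ↑ʳ_))))

open import Algebra.Properties.Semiring.Sum (CommutativeRing.semiring ℚ.+-*-commutativeRing)
  using (sum; sum-syntax; sum-cong-≗; sum-replicate-zero; ∑-distrib-+; ∑-comm; *-distribˡ-sum)
import Algebra.Properties.CommutativeMonoid.Sum ℕ.+-0-commutativeMonoid as ℕΣ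
open ≡-Reasoning
open +-*-Solver using (solve; _:+_; _:*_; :-_; _:-_; _:=_; con)

Σℚ≡∑ : ∀ n (f : Fin n → ℚ) → Σℚ n f ≡ sum f
Σℚ≡∑ zero    f = refl
Σℚ≡∑ (suc n) f = cong (f zero +_) (Σℚ≡∑ n (f ∘ suc))

∑-zero : ∀ {n} {f : Vector ℚ n} → (∀ i → f i ≡ 0ℚ) → sum f ≡ 0ℚ
∑-zero {n} f≡0 = trans (sum-cong-≗ f≡0) (sum-replicate-zero n)

∑≢0⇒∃≢0 : ∀ {n} (f : Vector ℚ n) → sum f ≢ 0ℚ → ∃[ i ] f i ≢ 0ℚ
∑≢0⇒∃≢0 f ∑f≢0 with Fin.any? (λ i → ¬? (f i ℚ.≟ 0ℚ))
... | yes found = found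
... | no  none  = contradiction (∑-zero (λ i → decidable-stable (f i ℚ.≟ 0ℚ) (λ fi≢0 → none (i , fi≢0)))) ∑f≢0

∑-linear : ∀ {n} (f g : Vector ℚ n) s → ∑[ i < n ] (f i + s * g i) ≡ sum f + s * sum g
∑-linear f g s = trans (∑-distrib-+ f (λ i → s * g i)) (cong (sum f +_) (sym (*-distribˡ-sum s g)))

head-of-zero-sum : ∀ {n} (f : Vector ℚ (suc n)) → sum f ≡ 0ℚ → (∀ i → f (suc i) ≡ 0ℚ) → f zero ≡ 0ℚ
head-of-zero-sum f ∑f≡0 tail≡0 = begin
  f zero                  ≡⟨ ℚ.+-identityʳ (f zero) ⟨
  f zero + 0ℚ             ≡⟨ cong (f zero +_) (∑-zero tail≡0) ⟨
  f zero + sum (f ∘ suc)  ≡⟨ ∑f≡0 ⟩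
  0ℚ                      ∎

x*y≡0⇒y≡0 : ∀ {x y} → x ≢ 0ℚ → x * y ≡ 0ℚ → y ≡ 0ℚ
x*y≡0⇒y≡0 {x} {y} x≢0 xy≡0 = begin
  y              ≡⟨ ℚ.*-identityˡ y ⟨
  1ℚ * y         ≡⟨ cong (_* y) (ℚ.*-inverseˡ x) ⟨
  1/x * x * y    ≡⟨ ℚ.*-assoc 1/x x y ⟩
  1/x * (x * y)  ≡⟨ cong (1/x *_) xy≡0 ⟩
  1/x * 0ℚ       ≡⟨ ℚ.*-zeroʳ 1/x ⟩
  0ℚ             ∎
  where
  instance _ = ℚ.≢-nonZero x≢0
  1/x = ℚ.1/ x

-- Homogeneous linear systems

infix 7 _·_

_·_ : ∀ {N} → Vector ℚ N → Vector ℚ N → ℚ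
_·_ {N} a y = ∑[ x < N ] (a x * y x)

·-comm : ∀ {N} (a y : Vector ℚ N) → a · y ≡ y · a
·-comm a y = sum-cong-≗ (λ x → ℚ.*-comm (a x) (y x))

·-linear : ∀ {N} (a : Vector ℚ N) α u β v → a · (λ x → α * u x + β * v x) ≡ α * (a · u) + β * (a · v)
·-linear {N} a α u β v = begin
  a · (λ x → α * u x + β * v x)
    ≡⟨ sum-cong-≗ (λ x → distrib (a x) (u x) (v x)) ⟩
  ∑[ x < N ] (α * (a x * u x) + β * (a x * v x))
    ≡⟨ ∑-distrib-+ (λ x → α * (a x * u x)) (λ x → β * (a x * v x)) ⟩
  (∑[ x < N ] (α * (a x * u x))) + (∑[ x < N ] (β * (a x * v x)))
    ≡⟨ cong₂ _+_ (*-distribˡ-sum α (λ x → a x * u x)) (*-distribˡ-sum β (λ x → a x * v x)) ⟨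
  α * (a · u) + β * (a · v)
    ∎
  where
  distrib : ∀ a u v → a * (α * u + β * v) ≡ α * (a * u) + β * (a * v)
  distrib = solve 5 (λ α β a u v → a :* (α :* u :+ β :* v) := α :* (a :* u) :+ β :* (a :* v)) refl α β

δ : ∀ {N} → Fin N → Vector ℚ N
δ zero    zero    = 1ℚ
δ zero    (suc x) = 0ℚ
δ (suc p) zero    = 0ℚ
δ (suc p) (suc x) = δ p x

δ-diag : ∀ {N} (p : Fin N) → δ p p ≡ 1ℚ
δ-diag zero    = refl
δ-diag (suc p) = δ-diag p

δ-offdiag : ∀ {N} {p x : Fin N} → x ≢ p → δ p x ≡ 0ℚ
δ-offdiag {p = zero}  {zero}  x≢p = contradiction refl x≢p
δ-offdiag {p = zero}  {suc x} x≢p = refl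
δ-offdiag {p = suc p} {zero}  x≢p = refl
δ-offdiag {p = suc p} {suc x} x≢p = δ-offdiag (x≢p ∘ cong suc)

δ-· : ∀ {N} (p : Fin N) (f : Vector ℚ N) → δ p · f ≡ f p
δ-· {suc N} zero    f = begin
  1ℚ * f zero + ∑[ x < N ] (0ℚ * f (suc x))
    ≡⟨ cong₂ _+_ (ℚ.*-identityˡ (f zero)) (∑-zero (λ x → ℚ.*-zeroˡ (f (suc x)))) ⟩
  f zero + 0ℚ
    ≡⟨ ℚ.+-identityʳ (f zero) ⟩
  f zero
    ∎
δ-· {suc N} (suc p) f = begin
  0ℚ * f zero + δ p · (f ∘ suc)  ≡⟨ cong₂ _+_ (ℚ.*-zeroˡ (f zero)) (δ-· p (f ∘ suc)) ⟩
  0ℚ + f (suc p)                 ≡⟨ ℚ.+-identityˡ (f (suc p)) ⟩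
  f (suc p)                      ∎

·-δ : ∀ {N} (f : Vector ℚ N) (p : Fin N) → f · δ p ≡ f p
·-δ f p = trans (·-comm f (δ p)) (δ-· p f)

x∈p⇒∣p∣≡1+∣p-x∣ : ∀ {N} {x : Fin N} {p : Subset N} → x ∈ p → ∣ p ∣ ≡ suc ∣ p - x ∣
x∈p⇒∣p∣≡1+∣p-x∣ {p = inside  ∷ p} here        = cong (suc ∘ ∣_∣) (sym (p─⊥≡p p))
x∈p⇒∣p∣≡1+∣p-x∣ {p = inside  ∷ p} (there x∈p) = cong suc (x∈p⇒∣p∣≡1+∣p-x∣ x∈p)
x∈p⇒∣p∣≡1+∣p-x∣ {p = outside ∷ p} (there x∈p) = x∈p⇒∣p∣≡1+∣p-x∣ x∈p

x∉p-x : ∀ {N} {x : Fin N} (p : Subset N) → x ∉ p - x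
x∉p-x {x = zero}  (s ∷ p) ()
x∉p-x {x = suc x} (s ∷ p) x∈p-x = x∉p-x p (drop-there x∈p-x)

∣p∣>0⇒nonempty : ∀ {N} (p : Subset N) → 0 < ∣ p ∣ → Nonempty p
∣p∣>0⇒nonempty {N} p 0<∣p∣ with nonempty? p
... | yes p≢∅ = p≢∅
... | no  p≡∅ = contradiction (trans (cong ∣_∣ (Empty-unique p≡∅)) (∣⊥∣≡0 N)) (ℕ.>⇒≢ 0<∣p∣)

SupportedIn : ∀ {N} → Vector ℚ N → Subset N → Set
SupportedIn y S = ∀ x → x ∉ S → y x ≡ 0ℚ

record NontrivialSolution {N m} (as : Vec (Vector ℚ N) m) (S : Subset N) : Set where
  constructor solution
  field
    vector      : Vector ℚ N
    supported   : SupportedIn vector S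
    nonzero     : ∃[ x ] vector x ≢ 0ℚ
    annihilated : VecAll.All (λ a → a · vector ≡ 0ℚ) as

vanishesOn⇒·≡0 : ∀ {N} {a y : Vector ℚ N} {S} → (∀ x → x ∈ S → a x ≡ 0ℚ) → SupportedIn y S → a · y ≡ 0ℚ
vanishesOn⇒·≡0 {a = a} {y} {S} a≡0 y≡0 = ∑-zero term
  where
  term : ∀ x → a x * y x ≡ 0ℚ
  term x with x ∈? S
  ... | yes x∈S = trans (cong (_* y x) (a≡0 x x∈S)) (ℚ.*-zeroˡ (y x))
  ... | no  x∉S = trans (cong (a x *_) (y≡0 x x∉S)) (ℚ.*-zeroʳ (a x))

eliminate : ∀ {N} → Vector ℚ N → Fin N → Vector ℚ N → Vector ℚ N
eliminate a p b x = a p * b x + (- b p) * a x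

backSubstitute : ∀ {N} → Vector ℚ N → Fin N → Vector ℚ N → Vector ℚ N
backSubstitute a p y x = a p * y x + (- (a · y)) * δ p x

eliminate-· : ∀ {N} (a : Vector ℚ N) p b y → eliminate a p b · y ≡ a p * (b · y) + (- b p) * (a · y)
eliminate-· a p b y = begin
  eliminate a p b · y                ≡⟨ ·-comm (eliminate a p b) y ⟩
  y · eliminate a p b                ≡⟨ ·-linear y (a p) b (- b p) a ⟩
  a p * (y · b) + (- b p) * (y · a)  ≡⟨ cong₂ (λ u v → a p * u + (- b p) * v) (·-comm y b) (·-comm y a) ⟩
  a p * (b · y) + (- b p) * (a · y)  ∎

·-backSubstitute : ∀ {N} (a : Vector ℚ N) p b y → b · backSubstitute a p y ≡ eliminate a p b · y
·-backSubstitute a p b y = begin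
  b · backSubstitute a p y                  ≡⟨ ·-linear b (a p) y (- (a · y)) (δ p) ⟩
  a p * (b · y) + (- (a · y)) * (b · δ p)   ≡⟨ cong (λ v → a p * (b · y) + (- (a · y)) * v) (·-δ b p) ⟩
  a p * (b · y) + (- (a · y)) * b p         ≡⟨ cong (a p * (b · y) +_) (solve 2 (λ c u → (:- c) :* u := (:- u) :* c) refl (a · y) (b p)) ⟩
  a p * (b · y) + (- b p) * (a · y)         ≡⟨ eliminate-· a p b y ⟨
  eliminate a p b · y                       ∎

eliminate-self : ∀ {N} (a : Vector ℚ N) p y → eliminate a p a · y ≡ 0ℚ
eliminate-self a p y = trans (eliminate-· a p a y) (solve 2 (λ u c → u :* c :+ (:- u) :* c := con 0ℚ) refl (a p) (a · y))

backSubstitute-solution : ∀ {N m} {a : Vector ℚ N} {as : Vec (Vector ℚ N) m} {S p} → p ∈ S → a p ≢ 0ℚ →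
  NontrivialSolution (Vec.map (eliminate a p) as) (S - p) → NontrivialSolution (a ∷ as) S
backSubstitute-solution {a = a} {S = S} {p} p∈S ap≢0 (solution y y-supported (q , yq≢0) y-annihilated) =
  solution x x-supported (q , xq≢0)
    (trans (·-backSubstitute a p a y) (eliminate-self a p y)
     ∷ VecAll.map (trans (·-backSubstitute a p _ y)) (VecAll.map⁻ y-annihilated))
  where
  x = backSubstitute a p y

  x-off-p : ∀ {z} → z ≢ p → x z ≡ a p * y z
  x-off-p {z} z≢p = begin
    a p * y z + (- (a · y)) * δ p z  ≡⟨ cong (λ v → a p * y z + (- (a · y)) * v) (δ-offdiag z≢p) ⟩
    a p * y z + (- (a · y)) * 0ℚ     ≡⟨ cong (a p * y z +_) (ℚ.*-zeroʳ (- (a · y))) ⟩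
    a p * y z + 0ℚ                   ≡⟨ ℚ.+-identityʳ (a p * y z) ⟩
    a p * y z                        ∎

  x-supported : SupportedIn x S
  x-supported z z∉S = begin
    x z        ≡⟨ x-off-p (λ { refl → z∉S p∈S }) ⟩
    a p * y z  ≡⟨ cong (a p *_) (y-supported z (z∉S ∘ p─q⊆p S _)) ⟩
    a p * 0ℚ   ≡⟨ ℚ.*-zeroʳ (a p) ⟩
    0ℚ         ∎

  xq≢0 : x q ≢ 0ℚ
  xq≢0 xq≡0 = yq≢0 (x*y≡0⇒y≡0 ap≢0 (trans (sym (x-off-p q≢p)) xq≡0))
    where
    q≢p : q ≢ p
    q≢p refl = yq≢0 (y-supported p (x∉p-x S))

-- Gaussian elimination with pivots chosen in S.
nontrivial-solution : ∀ {N m} (as : Vec (Vector ℚ N) m) (S : Subset N) → m < ∣ S ∣ → NontrivialSolution as S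
nontrivial-solution [] S 0<∣S∣ with p , p∈S ← ∣p∣>0⇒nonempty S 0<∣S∣ =
  solution (δ p) (λ x x∉S → δ-offdiag {p = p} (λ { refl → x∉S p∈S })) (p , ℚ.1≢0 ∘ trans (sym (δ-diag p))) []
nontrivial-solution (a ∷ as) S m<∣S∣ with Fin.any? (λ x → x ∈? S ×-dec ¬? (a x ℚ.≟ 0ℚ))
... | yes (p , p∈S , ap≢0) =
  backSubstitute-solution p∈S ap≢0
    (nontrivial-solution (Vec.map (eliminate a p) as) (S - p) (ℕ.≤-pred (subst (_ <_) (x∈p⇒∣p∣≡1+∣p-x∣ p∈S) m<∣S∣)))
... | no  no-pivot with solution y y-supported y≢0 y-annihilated ← nontrivial-solution as S (ℕ.<⇒≤ m<∣S∣) =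
  solution y y-supported y≢0 (vanishesOn⇒·≡0 a≡0-on-S y-supported ∷ y-annihilated)
  where
  a≡0-on-S : ∀ x → x ∈ S → a x ≡ 0ℚ
  a≡0-on-S x x∈S = decidable-stable (a x ℚ.≟ 0ℚ) (λ ax≢0 → no-pivot (x , x∈S , ax≢0))

-- Slices of a tensor

data Orientation : Set where
  horizontal lateral frontal : Orientation

slice : ∀ {n} → Orientation → Fin n → Tensor n → Fin n → Fin n → ℚ
slice horizontal i A j k = A i j k
slice lateral    j A i k = A i j k
slice frontal    k A i j = A i j k

sliceSum : ∀ {n} → Orientation → Fin n → Tensor n → ℚ
sliceSum {n} o p A = ∑[ a < n ] ∑[ b < n ] slice o p A a b

SliceSums : ∀ {n} → ℚ → Tensor n → Set
SliceSums c A = ∀ o p → sliceSum o p A ≡ c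

Σℚ²≡sliceSum : ∀ {n} o p (A : Tensor n) → Σℚ n (λ a → Σℚ n (slice o p A a)) ≡ sliceSum o p A
Σℚ²≡sliceSum {n} o p A = trans (Σℚ≡∑ n _) (sum-cong-≗ (λ a → Σℚ≡∑ n (slice o p A a)))

planeStochastic⇒sliceSums : ∀ {n} {A : Tensor n} → PlaneStochastic n A → SliceSums 1ℚ A
planeStochastic⇒sliceSums {A = A} (_ , _ , sums , _) horizontal i = trans (sym (Σℚ²≡sliceSum horizontal i A)) (sums i)
planeStochastic⇒sliceSums {A = A} (_ , _ , _ , sums) lateral    j = trans (sym (Σℚ²≡sliceSum lateral j A)) (sums j)
planeStochastic⇒sliceSums {A = A} (_ , sums , _ , _) frontal    k = trans (sym (Σℚ²≡sliceSum frontal k A)) (sums k)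

sliceSums⇒planeStochastic : ∀ {n} {A : Tensor n} → (∀ i j k → 0ℚ ℚ.≤ A i j k) → SliceSums 1ℚ A → PlaneStochastic n A
sliceSums⇒planeStochastic {A = A} A≥0 sums = A≥0 , sums′ frontal , sums′ horizontal , sums′ lateral
  where
  sums′ : ∀ o p → Σℚ _ (λ a → Σℚ _ (slice o p A a)) ≡ 1ℚ
  sums′ o p = trans (Σℚ²≡sliceSum o p A) (sums o p)

_⊕_⊛_ : ∀ {n} → Tensor n → ℚ → Tensor n → Tensor n
(A ⊕ s ⊛ D) i j k = A i j k + s * D i j k

sliceSum-linear : ∀ {n} o p (A : Tensor n) s D → sliceSum o p (A ⊕ s ⊛ D) ≡ sliceSum o p A + s * sliceSum o p D
sliceSum-linear {n} o p A s D = begin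
  ∑[ a < n ] ∑[ b < n ] slice o p (A ⊕ s ⊛ D) a b
    ≡⟨ sum-cong-≗ (λ a → sum-cong-≗ (slice-linear o a)) ⟩
  ∑[ a < n ] ∑[ b < n ] (slice o p A a b + s * slice o p D a b)
    ≡⟨ sum-cong-≗ (λ a → ∑-linear (slice o p A a) (slice o p D a) s) ⟩
  ∑[ a < n ] ((∑[ b < n ] slice o p A a b) + s * (∑[ b < n ] slice o p D a b))
    ≡⟨ ∑-linear (λ a → ∑[ b < n ] slice o p A a b) (λ a → ∑[ b < n ] slice o p D a b) s ⟩
  sliceSum o p A + s * sliceSum o p D
    ∎
  where
  slice-linear : ∀ o a b → slice o p (A ⊕ s ⊛ D) a b ≡ slice o p A a b + s * slice o p D a b
  slice-linear horizontal a b = refl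
  slice-linear lateral    a b = refl
  slice-linear frontal    a b = refl

total : ∀ {n} → Tensor n → ℚ
total {n} T = ∑[ i < n ] ∑[ j < n ] ∑[ k < n ] T i j k

total≡∑sliceSum : ∀ {n} o (T : Tensor n) → total T ≡ ∑[ p < n ] sliceSum o p T
total≡∑sliceSum     horizontal T = refl
total≡∑sliceSum {n} lateral    T = ∑-comm (λ i j → ∑[ k < n ] T i j k)
total≡∑sliceSum {n} frontal    T = trans (sum-cong-≗ (λ i → ∑-comm (T i))) (∑-comm (λ i k → ∑[ j < n ] T i j k))

-- Each family of slices sums to the total.
sliceSums-from-independent : ∀ {n} (T : Tensor (suc n)) → (∀ k → sliceSum frontal k T ≡ 0ℚ) →
  (∀ i → sliceSum horizontal (suc i) T ≡ 0ℚ) → (∀ j → sliceSum lateral (suc j) T ≡ 0ℚ) → SliceSums 0ℚ T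
sliceSums-from-independent T frontal≡0 horizontal≡0 lateral≡0 = sums
  where
  first≡0 : ∀ o → (∀ p → sliceSum o (suc p) T ≡ 0ℚ) → sliceSum o zero T ≡ 0ℚ
  first≡0 o rest≡0 = head-of-zero-sum (λ p → sliceSum o p T)
    (trans (sym (total≡∑sliceSum o T)) (trans (total≡∑sliceSum frontal T) (∑-zero frontal≡0))) rest≡0
  sums : SliceSums 0ℚ T
  sums frontal    k       = frontal≡0 k
  sums horizontal zero    = first≡0 horizontal horizontal≡0
  sums horizontal (suc i) = horizontal≡0 i
  sums lateral    zero    = first≡0 lateral lateral≡0
  sums lateral    (suc j) = lateral≡0 j

∣x∣≤a⇒0≤a+x : ∀ {a x} → ℚ.∣ x ∣ ℚ.≤ a → 0ℚ ℚ.≤ a + x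
∣x∣≤a⇒0≤a+x {a} {x} ∣x∣≤a with ℚ.∣p∣≡p∨∣p∣≡-p x
... | inj₁ ∣x∣≡x  = ℚ.+-mono-≤ (ℚ.≤-trans (ℚ.0≤∣p∣ x) ∣x∣≤a) (ℚ.∣p∣≡p⇒0≤p ∣x∣≡x)
... | inj₂ ∣x∣≡-x = subst (ℚ._≤ a + x) (ℚ.+-inverseˡ x) (ℚ.+-monoˡ-≤ x (subst (ℚ._≤ a) ∣x∣≡-x ∣x∣≤a))

common-positive-bound : ∀ m {Q : Fin m → ℚ → Set} → (∀ {x s t} → s ℚ.≤ t → Q x t → Q x s) →
                        (∀ x → ∃[ t ] 0ℚ ℚ.< t × Q x t) → ∃[ t ] 0ℚ ℚ.< t × (∀ x → Q x t)
common-positive-bound zero    antitone bounds = 1ℚ , ℚ.positive⁻¹ 1ℚ , λ ()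
common-positive-bound (suc m) antitone bounds
  with t₀ , 0<t₀ , Q₀ ← bounds zero
     | t , 0<t , Q ← common-positive-bound m antitone (bounds ∘ suc) =
  t₀ ℚ.⊓ t , 0<t₀⊓t , λ { zero → antitone (ℚ.p⊓q≤p t₀ t) Q₀ ; (suc x) → antitone (ℚ.p⊓q≤q t₀ t) (Q x) }
  where
  0<t₀⊓t : 0ℚ ℚ.< t₀ ℚ.⊓ t
  0<t₀⊓t with ℚ.⊓-sel t₀ t
  ... | inj₁ t₀⊓t≡t₀ = subst (0ℚ ℚ.<_) (sym t₀⊓t≡t₀) 0<t₀
  ... | inj₂ t₀⊓t≡t  = subst (0ℚ ℚ.<_) (sym t₀⊓t≡t) 0<t

entry-bound : ∀ {a e} → 0ℚ ℚ.≤ a → (a ≡ 0ℚ → e ≡ 0ℚ) → ∃[ t ] 0ℚ ℚ.< t × t * ℚ.∣ e ∣ ℚ.≤ a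
entry-bound {a} {e} 0≤a e⊆a with e ℚ.≟ 0ℚ
... | yes refl = 1ℚ , ℚ.positive⁻¹ 1ℚ , 0≤a
... | no  e≢0  = a * 1/∣e∣ , ℚ.positive⁻¹ (a * 1/∣e∣) , ℚ.≤-reflexive a*1/∣e∣*∣e∣≡a
  where
  instance
    ∣e∣-nonZero      = ℚ.≢-nonZero (e≢0 ∘ ℚ.∣p∣≡0⇒p≡0 e)
    ∣e∣-positive     = ℚ.nonNeg∧nonZero⇒pos ℚ.∣ e ∣ {{ℚ.∣-∣-nonNeg e}}
    a-positive       = ℚ.nonNeg∧nonZero⇒pos a {{ℚ.nonNegative 0≤a}} {{ℚ.≢-nonZero (e≢0 ∘ e⊆a)}}
    1/∣e∣-positive   = ℚ.1/pos⇒pos ℚ.∣ e ∣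
    a*1/∣e∣-positive = ℚ.pos*pos⇒pos a (ℚ.1/ ℚ.∣ e ∣)
  1/∣e∣ = ℚ.1/ ℚ.∣ e ∣
  a*1/∣e∣*∣e∣≡a : a * 1/∣e∣ * ℚ.∣ e ∣ ≡ a
  a*1/∣e∣*∣e∣≡a = begin
    a * 1/∣e∣ * ℚ.∣ e ∣    ≡⟨ ℚ.*-assoc a 1/∣e∣ ℚ.∣ e ∣ ⟩
    a * (1/∣e∣ * ℚ.∣ e ∣)  ≡⟨ cong (a *_) (ℚ.*-inverseˡ ℚ.∣ e ∣) ⟩
    a * 1ℚ                 ≡⟨ ℚ.*-identityʳ a ⟩
    a                      ∎

perturbation-bound : ∀ {n} {A D : Tensor n} → (∀ i j k → 0ℚ ℚ.≤ A i j k) → (∀ i j k → A i j k ≡ 0ℚ → D i j k ≡ 0ℚ) →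
                     ∃[ t ] 0ℚ ℚ.< t × (∀ i j k → t * ℚ.∣ D i j k ∣ ℚ.≤ A i j k)
perturbation-bound {n} {A} {D} A≥0 D⊆A =
  common-positive-bound n (λ s≤t bound j k → scaled s≤t (bound j k)) λ i →
  common-positive-bound n (λ s≤t bound k → scaled s≤t (bound k)) λ j →
  common-positive-bound n scaled λ k →
  entry-bound (A≥0 i j k) (D⊆A i j k)
  where
  scaled : ∀ {a e s t} → s ℚ.≤ t → t * ℚ.∣ e ∣ ℚ.≤ a → s * ℚ.∣ e ∣ ℚ.≤ a
  scaled {e = e} s≤t bound = ℚ.≤-trans (ℚ.*-monoʳ-≤-nonNeg ℚ.∣ e ∣ {{ℚ.∣-∣-nonNeg e}} s≤t) bound

vertex-rigid : ∀ {n} {A : Tensor n} → IsVertex n A → ∀ D → (∀ i j k → A i j k ≡ 0ℚ → D i j k ≡ 0ℚ) →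
               SliceSums 0ℚ D → ∀ i j k → D i j k ≡ 0ℚ
vertex-rigid {n} {A} (A-stochastic , extreme) D D⊆A D-sums i j k = x*y≡0⇒y≡0 t+t≢0 (begin
  (t + t) * D i j k
    ≡⟨ solve 3 (λ a t d → (t :+ t) :* d := (a :+ t :* d) :- (a :+ (:- t) :* d)) refl (A i j k) t (D i j k) ⟩
  (A ⊕ t ⊛ D) i j k ℚ.- (A ⊕ (- t) ⊛ D) i j k
    ≡⟨ cong (ℚ._- (A ⊕ (- t) ⊛ D) i j k) (A+tD≐A-tD i j k) ⟩
  (A ⊕ (- t) ⊛ D) i j k ℚ.- (A ⊕ (- t) ⊛ D) i j k
    ≡⟨ ℚ.+-inverseʳ ((A ⊕ (- t) ⊛ D) i j k) ⟩
  0ℚ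
    ∎)
  where
  bound = perturbation-bound (proj₁ A-stochastic) D⊆A
  t = proj₁ bound

  0<t : 0ℚ ℚ.< t
  0<t = proj₁ (proj₂ bound)

  t+t≢0 : t + t ≢ 0ℚ
  t+t≢0 = ℚ.<⇒≢ (ℚ.+-mono-< 0<t 0<t) ∘ sym

  ∣t∣≡t : ℚ.∣ t ∣ ≡ t
  ∣t∣≡t = ℚ.0≤p⇒∣p∣≡p (ℚ.<⇒≤ 0<t)

  stochastic : ∀ s → ℚ.∣ s ∣ ≡ t → PlaneStochastic n (A ⊕ s ⊛ D)
  stochastic s ∣s∣≡t = sliceSums⇒planeStochastic nonnegative sums
    where
    nonnegative : ∀ i j k → 0ℚ ℚ.≤ A i j k + s * D i j k
    nonnegative i j k = ∣x∣≤a⇒0≤a+x (subst (ℚ._≤ A i j k)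
      (sym (trans (ℚ.∣p*q∣≡∣p∣*∣q∣ s (D i j k)) (cong (ℚ._* ℚ.∣ D i j k ∣) ∣s∣≡t)))
      (proj₂ (proj₂ bound) i j k))
    sums : SliceSums 1ℚ (A ⊕ s ⊛ D)
    sums o p = begin
      sliceSum o p (A ⊕ s ⊛ D)             ≡⟨ sliceSum-linear o p A s D ⟩
      sliceSum o p A + s * sliceSum o p D  ≡⟨ cong₂ (λ u v → u + s * v) (planeStochastic⇒sliceSums A-stochastic o p) (D-sums o p) ⟩
      1ℚ + s * 0ℚ                          ≡⟨ cong (1ℚ +_) (ℚ.*-zeroʳ s) ⟩
      1ℚ                                   ∎

  A+tD≐A-tD : (A ⊕ t ⊛ D) ≐ (A ⊕ (- t) ⊛ D)
  A+tD≐A-tD = extreme (A ⊕ t ⊛ D) (A ⊕ (- t) ⊛ D) ½ (stochastic t ∣t∣≡t) (stochastic (- t) (trans (ℚ.∣-p∣≡∣p∣ t) ∣t∣≡t))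
                (ℚ.positive⁻¹ ½) (from-yes (½ ℚ.<? 1ℚ))
                (λ i j k → solve 3 (λ a t d → a := con ½ :* (a :+ t :* d) :+ (con 1ℚ :- con ½) :* (a :+ (:- t) :* d))
                                   refl (A i j k) t (D i j k))

-- Cells are indexed by Fin (n * (n * n)) rather than Fin (n ^ 3), which unfolds to
-- Fin (n * (n * (n * 1))), so that remQuot and combine apply directly.
cell : ∀ {n} → Fin (n ℕ.* (n ℕ.* n)) → Fin n × Fin n × Fin n
cell {n} x = Product.map₂ (Fin.remQuot n) (Fin.remQuot (n ℕ.* n) x)

index : ∀ {n} → Fin n → Fin n → Fin n → Fin (n ℕ.* (n ℕ.* n))
index i j k = combine i (combine j k)

cell-index : ∀ {n} (i j k : Fin n) → cell (index i j k) ≡ (i , j , k)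
cell-index {n} i j k = begin
  Product.map₂ (Fin.remQuot n) (Fin.remQuot (n ℕ.* n) (combine i (combine j k)))
    ≡⟨ cong (Product.map₂ (Fin.remQuot n)) (Fin.remQuot-combine i (combine j k)) ⟩
  (i , Fin.remQuot n (combine j k))
    ≡⟨ cong (i ,_) (Fin.remQuot-combine j k) ⟩
  (i , j , k)
    ∎

entry : ∀ {n} → Tensor n → Fin n × Fin n × Fin n → ℚ
entry T (i , j , k) = T i j k

flatten : ∀ {n} → Tensor n → Vector ℚ (n ℕ.* (n ℕ.* n))
flatten T = entry T ∘ cell

unflatten : ∀ {n} → Vector ℚ (n ℕ.* (n ℕ.* n)) → Tensor n
unflatten y i j k = y (index i j k)

flatten-index : ∀ {n} (T : Tensor n) i j k → flatten T (index i j k) ≡ T i j k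
flatten-index T i j k = cong (entry T) (cell-index i j k)

unflatten-cell : ∀ {n} (y : Vector ℚ (n ℕ.* (n ℕ.* n))) x → entry (unflatten {n} y) (cell x) ≡ y x
unflatten-cell {n} y x = begin
  entry (unflatten {n} y) (cell x)  ≡⟨ cong (y ∘ combine i) (Fin.combine-remQuot {n} n r) ⟩
  y (combine i r)                   ≡⟨ cong y (Fin.combine-remQuot {n} (n ℕ.* n) x) ⟩
  y x                               ∎
  where
  i = proj₁ (Fin.remQuot {n} (n ℕ.* n) x)
  r = proj₂ (Fin.remQuot {n} (n ℕ.* n) x)

sum≡total-unflatten : ∀ {n} (y : Vector ℚ (n ℕ.* (n ℕ.* n))) → sum y ≡ total (unflatten {n} y)
sum≡total-unflatten {n} y =
  trans (sum-combine ℚ.+-0-monoid n y) (sum-cong-≗ (λ i → sum-combine ℚ.+-0-monoid n (y ∘ combine {n} i)))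

coordinate : ∀ {n} → Orientation → Fin n × Fin n × Fin n → Fin n
coordinate horizontal (i , j , k) = i
coordinate lateral    (i , j , k) = j
coordinate frontal    (i , j , k) = k

total-δ : ∀ {n} o p (T : Tensor n) → total (λ i j k → δ p (coordinate o (i , j , k)) * T i j k) ≡ sliceSum o p T
total-δ {n} horizontal p T = begin
  ∑[ i < n ] ∑[ j < n ] ∑[ k < n ] (δ p i * T i j k)
    ≡⟨ sum-cong-≗ (λ i → *-distribˡ-sum² (δ p i) (T i)) ⟨
  δ p · (λ i → ∑[ j < n ] ∑[ k < n ] T i j k)
    ≡⟨ δ-· p (λ i → ∑[ j < n ] ∑[ k < n ] T i j k) ⟩
  sliceSum horizontal p T
    ∎
  where
  *-distribˡ-sum² : ∀ c (f : Fin n → Fin n → ℚ) → c * ∑[ j < n ] ∑[ k < n ] f j k ≡ ∑[ j < n ] ∑[ k < n ] (c * f j k)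
  *-distribˡ-sum² c f = trans (*-distribˡ-sum c (λ j → ∑[ k < n ] f j k)) (sum-cong-≗ (λ j → *-distribˡ-sum c (f j)))
total-δ {n} lateral p T = begin
  ∑[ i < n ] ∑[ j < n ] ∑[ k < n ] (δ p j * T i j k)
    ≡⟨ sum-cong-≗ (λ i → sum-cong-≗ (λ j → *-distribˡ-sum (δ p j) (T i j))) ⟨
  ∑[ i < n ] (δ p · (λ j → ∑[ k < n ] T i j k))
    ≡⟨ sum-cong-≗ (λ i → δ-· p (λ j → ∑[ k < n ] T i j k)) ⟩
  sliceSum lateral p T
    ∎
total-δ frontal p T = sum-cong-≗ (λ i → sum-cong-≗ (λ j → δ-· p (T i j)))

sliceForm : ∀ {n} → Orientation → Fin n → Vector ℚ (n ℕ.* (n ℕ.* n))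
sliceForm o p x = δ p (coordinate o (cell x))

sliceForm-· : ∀ {n} o p (y : Vector ℚ (n ℕ.* (n ℕ.* n))) → sliceForm o p · y ≡ sliceSum o p (unflatten {n} y)
sliceForm-· {n} o p y = begin
  sliceForm o p · y
    ≡⟨ sum≡total-unflatten {n} (λ x → sliceForm o p x * y x) ⟩
  total (λ i j k → δ p (coordinate o (cell (index {n} i j k))) * y (index i j k))
    ≡⟨ sum-cong-≗ (λ i → sum-cong-≗ (λ j → sum-cong-≗ (λ k →
         cong (λ c → δ p (coordinate o c) * y (index {n} i j k)) (cell-index i j k)))) ⟩
  total (λ i j k → δ p (coordinate o (i , j , k)) * unflatten {n} y i j k)
    ≡⟨ total-δ o p (unflatten y) ⟩
  sliceSum o p (unflatten y)
    ∎

independentSliceForms : ∀ n → Vec (Vector ℚ (suc n ℕ.* (suc n ℕ.* suc n))) (suc n ℕ.+ (n ℕ.+ n))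
independentSliceForms n =
  Vec.tabulate (sliceForm {suc n} frontal) Vec.++
  Vec.tabulate (sliceForm {suc n} horizontal ∘ suc) Vec.++
  Vec.tabulate (sliceForm {suc n} lateral ∘ suc)

independentSliceForms⊥⇒sliceSums≡0 : ∀ {n} (y : Vector ℚ (suc n ℕ.* (suc n ℕ.* suc n))) →
  VecAll.All (λ a → a · y ≡ 0ℚ) (independentSliceForms n) → SliceSums 0ℚ (unflatten {suc n} y)
independentSliceForms⊥⇒sliceSums≡0 {n} y annihilated =
  sliceSums-from-independent (unflatten y)
    (slices≡0 {frontal} {ps = λ k → k} frontal⊥) (slices≡0 {horizontal} {ps = suc} horizontal⊥) (slices≡0 {lateral} {ps = suc} lateral⊥)
  where
  frontal⊥    = proj₁ (VecAll.++⁻ (Vec.tabulate (sliceForm {suc n} frontal)) annihilated)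
  others⊥     = proj₂ (VecAll.++⁻ (Vec.tabulate (sliceForm {suc n} frontal)) annihilated)
  horizontal⊥ = proj₁ (VecAll.++⁻ (Vec.tabulate (sliceForm {suc n} horizontal ∘ suc)) others⊥)
  lateral⊥    = proj₂ (VecAll.++⁻ (Vec.tabulate (sliceForm {suc n} horizontal ∘ suc)) others⊥)
  slices≡0 : ∀ {o m} {ps : Fin m → Fin (suc n)} → VecAll.All (λ a → a · y ≡ 0ℚ) (Vec.tabulate (sliceForm o ∘ ps)) →
             ∀ q → sliceSum o (ps q) (unflatten y) ≡ 0ℚ
  slices≡0 {o} {ps = ps} ⊥ q = trans (sym (sliceForm-· o (ps q) y)) (VecAll.tabulate⁻ ⊥ q)

-- Supports

support : ∀ {N} → Vector ℚ N → Subset N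
support y = Vec.tabulate (λ x → not (does (y x ℚ.≟ 0ℚ)))

∈-support⁺ : ∀ {N} {y : Vector ℚ N} {x} → y x ≢ 0ℚ → x ∈ support y
∈-support⁺ {y = y} {x} yx≢0 = Vec.lookup⇒[]= x (support y) (trans (Vec.lookup∘tabulate _ x) bit≡true)
  where
  bit≡true : not (does (y x ℚ.≟ 0ℚ)) ≡ true
  bit≡true with y x ℚ.≟ 0ℚ
  ... | yes yx≡0 = contradiction yx≡0 yx≢0
  ... | no  _    = refl

∈-support⁻ : ∀ {N} {y : Vector ℚ N} {x} → x ∈ support y → y x ≢ 0ℚ
∈-support⁻ {y = y} {x} x∈supp yx≡0 = bit≢true (trans (sym (Vec.lookup∘tabulate _ x)) (Vec.[]=⇒lookup x∈supp))
  where
  bit≢true : not (does (y x ℚ.≟ 0ℚ)) ≢ true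
  bit≢true with y x ℚ.≟ 0ℚ
  ... | yes _    = λ ()
  ... | no yx≢0  = contradiction yx≡0 yx≢0

tensorSupport : ∀ {n} → Tensor n → Subset (n ℕ.* (n ℕ.* n))
tensorSupport A = support (flatten A)

∈-tensorSupport : ∀ {n} {A : Tensor n} {i j k} → A i j k ≢ 0ℚ → index i j k ∈ tensorSupport A
∈-tensorSupport {A = A} {i} {j} {k} Aijk≢0 = ∈-support⁺ {y = flatten A} (Aijk≢0 ∘ trans (sym (flatten-index A i j k)))

∉-tensorSupport : ∀ {n} {A : Tensor n} {i j k} → A i j k ≡ 0ℚ → index i j k ∉ tensorSupport A
∉-tensorSupport {A = A} {i} {j} {k} Aijk≡0 ijk∈supp = ∈-support⁻ {y = flatten A} ijk∈supp (trans (flatten-index A i j k) Aijk≡0)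

same-support⇒≐ : ∀ {n} {A B : Tensor n} → IsVertex n A → IsVertex n B → tensorSupport A ≡ tensorSupport B → A ≐ B
same-support⇒≐ {n} {A} {B} A-vertex (B-stochastic , _) same i j k =
  difference≡0⇒≡ (vertex-rigid A-vertex (A ⊕ (- 1ℚ) ⊛ B) D⊆A D-sums i j k)
  where
  difference≡0⇒≡ : ∀ {a b} → a + (- 1ℚ) * b ≡ 0ℚ → a ≡ b
  difference≡0⇒≡ {a} {b} a-b≡0 = begin
    a                     ≡⟨ solve 2 (λ a b → a := (a :+ (:- con 1ℚ) :* b) :+ b) refl a b ⟩
    a + (- 1ℚ) * b + b    ≡⟨ cong (_+ b) a-b≡0 ⟩
    0ℚ + b                ≡⟨ ℚ.+-identityˡ b ⟩
    b                     ∎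

  D⊆A : ∀ i j k → A i j k ≡ 0ℚ → A i j k + (- 1ℚ) * B i j k ≡ 0ℚ
  D⊆A i j k Aijk≡0 = cong₂ (λ a b → a + (- 1ℚ) * b) Aijk≡0 Bijk≡0
    where
    Bijk≡0 : B i j k ≡ 0ℚ
    Bijk≡0 = decidable-stable (B i j k ℚ.≟ 0ℚ) λ Bijk≢0 →
      ∉-tensorSupport {A = A} Aijk≡0 (subst (index i j k ∈_) (sym same) (∈-tensorSupport {A = B} Bijk≢0))

  D-sums : SliceSums 0ℚ (A ⊕ (- 1ℚ) ⊛ B)
  D-sums o p = begin
    sliceSum o p (A ⊕ (- 1ℚ) ⊛ B)             ≡⟨ sliceSum-linear o p A (- 1ℚ) B ⟩
    sliceSum o p A + (- 1ℚ) * sliceSum o p B  ≡⟨ cong₂ (λ a b → a + (- 1ℚ) * b)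
                                                        (planeStochastic⇒sliceSums (proj₁ A-vertex) o p)
                                                        (planeStochastic⇒sliceSums B-stochastic o p) ⟩
    1ℚ + (- 1ℚ) * 1ℚ                          ≡⟨⟩
    0ℚ                                        ∎

support-upper-bound : ∀ {n} {A : Tensor (suc n)} → IsVertex (suc n) A → ∣ tensorSupport A ∣ ≤ suc n ℕ.+ (n ℕ.+ n)
support-upper-bound {n} {A} A-vertex with ∣ tensorSupport A ∣ ℕ.≤? suc n ℕ.+ (n ℕ.+ n)
... | yes bounded = bounded
... | no  unbounded
  with solution y y-supported (x , yx≢0) y-annihilated
         ← nontrivial-solution (independentSliceForms n) (tensorSupport A) (ℕ.≰⇒> unbounded) =
  contradiction (trans (sym (unflatten-cell {suc n} y x)) (D≡0 (proj₁ (cell x)) (proj₁ (proj₂ (cell x))) (proj₂ (proj₂ (cell x))))) yx≢0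
  where
  D≡0 : ∀ i j k → unflatten {suc n} y i j k ≡ 0ℚ
  D≡0 = vertex-rigid A-vertex (unflatten y) (λ i j k Aijk≡0 → y-supported (index i j k) (∉-tensorSupport {A = A} Aijk≡0))
          (independentSliceForms⊥⇒sliceSums≡0 y y-annihilated)

∣p∣≡∑ : ∀ {N} (p : Subset N) → ∣ p ∣ ≡ ℕΣ.sum (λ x → if Vec.lookup p x then 1 else 0)
∣p∣≡∑ []            = refl
∣p∣≡∑ (inside  ∷ p) = cong suc (∣p∣≡∑ p)
∣p∣≡∑ (outside ∷ p) = ∣p∣≡∑ p

term≤sum : ∀ {N} (f : Vector ℕ N) x → f x ≤ ℕΣ.sum f
term≤sum {suc N} f x = ℕ.≤-trans (ℕ.m≤m+n (f x) _) (ℕ.≤-reflexive (sym (ℕΣ.sum-remove {i = x} f)))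

n≤∑ : ∀ {n} (f : Vector ℕ n) → (∀ i → 1 ≤ f i) → n ≤ ℕΣ.sum f
n≤∑ {zero}  f 1≤f = z≤n
n≤∑ {suc n} f 1≤f = ℕ.+-mono-≤ (1≤f zero) (n≤∑ (f ∘ suc) (1≤f ∘ suc))

blocks-nonempty⇒n≤∣p∣ : ∀ {n M} (p : Subset (n ℕ.* M)) → (∀ i → ∃[ r ] combine i r ∈ p) → n ≤ ∣ p ∣
blocks-nonempty⇒n≤∣p∣ {n} {M} p nonempty =
  subst (n ≤_) (trans (sym (sum-combine ℕ.+-0-monoid n bit)) (sym (∣p∣≡∑ p))) (n≤∑ _ 1≤block)
  where
  bit : Fin (n ℕ.* M) → ℕ
  bit x = if Vec.lookup p x then 1 else 0
  1≤block : ∀ i → 1 ≤ ℕΣ.sum (λ r → bit (combine i r))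
  1≤block i with r , ir∈p ← nonempty i =
    ℕ.≤-trans (ℕ.≤-reflexive (cong (λ b → if b then 1 else 0) (sym (Vec.[]=⇒lookup ir∈p))))
              (term≤sum (λ r → bit (combine i r)) r)

support-lower-bound : ∀ {n} {A : Tensor n} → PlaneStochastic n A → n ≤ ∣ tensorSupport A ∣
support-lower-bound {n} {A} A-stochastic = blocks-nonempty⇒n≤∣p∣ (tensorSupport A) nonempty
  where
  nonempty : ∀ i → ∃[ r ] combine i r ∈ tensorSupport A
  nonempty i
    with j , slice≢0 ← ∑≢0⇒∃≢0 (λ j → ∑[ k < n ] A i j k) (ℚ.1≢0 ∘ trans (sym (planeStochastic⇒sliceSums A-stochastic horizontal i)))
    with k , Aijk≢0  ← ∑≢0⇒∃≢0 (A i j) slice≢0 =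
    combine j k , ∈-tensorSupport {A = A} Aijk≢0

-- Counting supports

subsetsOfSize : ∀ N → ℕ → List (Subset N)
subsetsOfSize zero    zero    = [] ∷ []
subsetsOfSize zero    (suc k) = []
subsetsOfSize (suc N) zero    = List.map (outside ∷_) (subsetsOfSize N zero)
subsetsOfSize (suc N) (suc k) = List.map (inside ∷_) (subsetsOfSize N k) ++ List.map (outside ∷_) (subsetsOfSize N (suc k))

length-subsetsOfSize : ∀ N k → length (subsetsOfSize N k) ≡ N C k
length-subsetsOfSize zero    zero    = refl
length-subsetsOfSize zero    (suc k) = refl
length-subsetsOfSize (suc N) zero    = trans (Listₚ.length-map _ (subsetsOfSize N zero)) (length-subsetsOfSize N zero)
length-subsetsOfSize (suc N) (suc k) = begin
  length (List.map (inside ∷_) (subsetsOfSize N k) ++ List.map (outside ∷_) (subsetsOfSize N (suc k)))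
    ≡⟨ Listₚ.length-++ (List.map (inside ∷_) (subsetsOfSize N k)) ⟩
  length (List.map (inside ∷_) (subsetsOfSize N k)) ℕ.+ length (List.map (outside ∷_) (subsetsOfSize N (suc k)))
    ≡⟨ cong₂ ℕ._+_ (trans (Listₚ.length-map _ (subsetsOfSize N k)) (length-subsetsOfSize N k))
                   (trans (Listₚ.length-map _ (subsetsOfSize N (suc k))) (length-subsetsOfSize N (suc k))) ⟩
  N C k ℕ.+ N C suc k
    ≡⟨ nCk+nC[k+1]≡[n+1]C[k+1] N k ⟩
  suc N C suc k
    ∎

∈-subsetsOfSize : ∀ {N} (p : Subset N) → p ∈ₗ subsetsOfSize N ∣ p ∣
∈-subsetsOfSize []            = here refl
∈-subsetsOfSize (inside  ∷ p) = ∈-++⁺ˡ (∈-map⁺ (inside ∷_) (∈-subsetsOfSize p))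
∈-subsetsOfSize (outside ∷ p) with ∣ p ∣ | ∈-subsetsOfSize p
... | zero  | p∈ = ∈-map⁺ (outside ∷_) p∈
... | suc k | p∈ = ∈-++⁺ʳ (List.map (inside ∷_) (subsetsOfSize _ k)) (∈-map⁺ (outside ∷_) p∈)

∈-─ : ∀ {A : Set} {x y : A} {ys} (x∈ys : x ∈ₗ ys) → y ∈ₗ ys → y ≢ x → y ∈ₗ (ys Any.─ x∈ys)
∈-─ (here refl)  (here refl)  y≢x = contradiction refl y≢x
∈-─ (here _)     (there y∈ys) _   = y∈ys
∈-─ (there _)    (here y≡z)   _   = here y≡z
∈-─ (there x∈ys) (there y∈ys) y≢x = there (∈-─ x∈ys y∈ys y≢x)

distinct⊆⇒length≤ : ∀ {A : Set} {xs ys : List A} → AllPairs _≢_ xs → All (_∈ₗ ys) xs → length xs ≤ length ys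
distinct⊆⇒length≤ [] [] = z≤n
distinct⊆⇒length≤ {ys = ys} (x≢xs ∷ distinct) (x∈ys ∷ xs⊆ys) =
  subst (_ ≤_) (sym (Listₚ.length-removeAt′ ys (Any.index x∈ys)))
    (s≤s (distinct⊆⇒length≤ distinct (All.zipWith (λ (y∈ys , x≢y) → ∈-─ x∈ys y∈ys (x≢y ∘ sym)) (xs⊆ys , x≢xs))))

length-concatMap : ∀ {A B : Set} (f : A → List B) xs → length (concatMap f xs) ≡ ℕ.sum (List.map (length ∘ f) xs)
length-concatMap f []       = refl
length-concatMap f (x ∷ xs) = trans (Listₚ.length-++ (f x)) (cong (length (f x) ℕ.+_) (length-concatMap f xs))

allowedSupports : ∀ n → List (Subset (n ℕ.* (n ℕ.* n)))
allowedSupports n = concatMap (λ m → subsetsOfSize (n ℕ.* (n ℕ.* n)) (n ℕ.+ m)) (upTo (2 ℕ.* n ∸ 1))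

length-allowedSupports : ∀ n → length (allowedSupports n) ≡ vertexBound n
length-allowedSupports n = begin
  length (concatMap (λ m → subsetsOfSize N (n ℕ.+ m)) ms)
    ≡⟨ length-concatMap (λ m → subsetsOfSize N (n ℕ.+ m)) ms ⟩
  ℕ.sum (List.map (λ m → length (subsetsOfSize N (n ℕ.+ m))) ms)
    ≡⟨ cong ℕ.sum (Listₚ.map-cong (λ m → length-subsetsOfSize N (n ℕ.+ m)) ms) ⟩
  ℕ.sum (List.map (λ m → N C (n ℕ.+ m)) ms)
    ≡⟨ cong (λ N → ℕ.sum (List.map (λ m → N C (n ℕ.+ m)) ms)) (cong (λ k → n ℕ.* (n ℕ.* k)) (ℕ.*-identityʳ n)) ⟨
  vertexBound n
    ∎
  where
  N = n ℕ.* (n ℕ.* n)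
  ms = upTo (2 ℕ.* n ∸ 1)

∈-allowedSupports : ∀ {n} (p : Subset (n ℕ.* (n ℕ.* n))) m → m < 2 ℕ.* n ∸ 1 → ∣ p ∣ ≡ n ℕ.+ m → p ∈ₗ allowedSupports n
∈-allowedSupports {n} p m m<2n-1 ∣p∣≡n+m =
  ∈-concatMap⁺ (λ k → subsetsOfSize N (n ℕ.+ k))
    (Any.map (λ m≡k → subst (λ k → p ∈ₗ subsetsOfSize N (n ℕ.+ k)) m≡k p∈) (∈-upTo⁺ m<2n-1))
  where
  N = n ℕ.* (n ℕ.* n)
  p∈ : p ∈ₗ subsetsOfSize N (n ℕ.+ m)
  p∈ = subst (λ k → p ∈ₗ subsetsOfSize N k) ∣p∣≡n+m (∈-subsetsOfSize p)

tensorSupport-allowed : ∀ {n} {A : Tensor (suc n)} → IsVertex (suc n) A → tensorSupport A ∈ₗ allowedSupports (suc n)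
tensorSupport-allowed {n} {A} A-vertex =
  ∈-allowedSupports (tensorSupport A) (∣S∣ ∸ suc n) m<2n-1 (sym (ℕ.m+[n∸m]≡n (support-lower-bound (proj₁ A-vertex))))
  where
  ∣S∣ = ∣ tensorSupport A ∣
  m≤n+n : ∣S∣ ∸ suc n ≤ n ℕ.+ n
  m≤n+n = subst (∣S∣ ∸ suc n ≤_) (ℕ.m+n∸m≡n (suc n) (n ℕ.+ n)) (ℕ.∸-monoˡ-≤ (suc n) (support-upper-bound A-vertex))
  2n-1≡1+n+n : 2 ℕ.* suc n ∸ 1 ≡ suc (n ℕ.+ n)
  2n-1≡1+n+n = trans (ℕ.+-suc n (n ℕ.+ 0)) (cong (λ k → suc (n ℕ.+ k)) (ℕ.+-identityʳ n))
  m<2n-1 : ∣S∣ ∸ suc n < 2 ℕ.* suc n ∸ 1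
  m<2n-1 = subst (∣S∣ ∸ suc n <_) (sym 2n-1≡1+n+n) (s≤s m≤n+n)

tensorSupports-distinct : ∀ {n} {vs : List (Tensor n)} → All (IsVertex n) vs → AllPairs (λ A B → ¬ (A ≐ B)) vs →
                          AllPairs _≢_ (List.map tensorSupport vs)
tensorSupports-distinct []                    []                = []
tensorSupports-distinct (A-vertex ∷ vertices) (A≉vs ∷ distinct) =
  Allₚ.map⁺ (All.zipWith (λ (B-vertex , A≉B) → A≉B ∘ same-support⇒≐ A-vertex B-vertex) (vertices , A≉vs))
  ∷ tensorSupports-distinct vertices distinct

mainTheorem8 : (n : ℕ) → 1 ≤ n → (vs : List (Tensor n))
    → All (IsVertex n) vs → AllPairs (λ A B → ¬ (A ≐ B)) vs
    → length vs ≤ vertexBound n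
mainTheorem8 (suc n) _ vs vertices distinct =
  subst₂ _≤_ (Listₚ.length-map tensorSupport vs) (length-allowedSupports (suc n))
    (distinct⊆⇒length≤ (tensorSupports-distinct vertices distinct) (Allₚ.map⁺ (All.map tensorSupport-allowed vertices)))
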